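{- Let $H$ be a fixed graph and let $d$ be its degeneracy. Let $g:\mathbb N\to\mathbb R$ be a function tending to infinity (arbitrarily slowly) as $n\to\infty$. Then w.h.p. $\tau(\mathcal P_H,n)\le g(n)\cdot n^{(d-1)/d}$; that is, there is a strategy for Builder in the online semi-random process such that with probability $1-o(1)$ his multigraph after $\lfloor g(n)n^{(d-1)/d}\rfloor$ rounds contains a copy of $H$.
   Context: Semi-random multigraph process (online version): fix $n$ and start with the empty multigraph on $[n]$. In each round $t$, a vertex $v_t$ is chosen uniformly at random from $[n]$, independently of all previous rounds; Builder then chooses $u_t\in[n]$ (possibly $u_t=v_t$), which may depend only on $v_1,\dots,v_t$, his earlier choices and his own randomness, and adds the edge $u_tv_t$ (loops and multiple edges allowed). For a monotone increasing property $\mathcal P$, $\tau_p(\mathcal P,n)$ is the least $m$ such that some strategy produces, after $m$ rounds, a multigraph in $\mathcal P$ with probability at least $p$; "w.h.p. $\tau(\mathcal P,n)\le m$" means $\tau_{1-o(1)}(\mathcal P,n)\le m$. $\mathcal P_H$ is the property of containing $H$ as a subgraph. The degeneracy of $H$ is the least $k$ such that every subgraph of $H$ has a vertex of degree at most $k$. -}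

module Defs where

open import Data.Nat using (ℕ; zero; suc; _+_; _*_; _∸_; _^_; _≤_)
open import Data.Bool using (Bool; true; false; if_then_else_)
open import Data.Fin using (Fin)
open import Data.List using (List; []; _∷_; map; allFin)
open import Data.Nat.ListAction using (sum)
open import Data.Vec using (Vec; []; _∷_)
open import Data.Product using (Σ; _×_; _,_; ∃-syntax)
open import Data.Sum using (_⊎_)
open import Function.Definitions using (Injective)
open import Relation.Binary.PropositionalEquality using (_≡_)
open import Data.List.Membership.Propositional using (_∈_)

record Graph : Set where
  field
    size   : ℕ
    adj    : Fin size → Fin size → Bool
    sym    : ∀ i j → adj i j ≡ adj j i
    irrefl : ∀ i → adj i i ≡ false
open Graph public

countFin : {k : ℕ} → (Fin k → Bool) → ℕ
countFin {k} f = sum (map (λ i → if f i then 1 else 0) (allFin k))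

record Subgraph (H : Graph) : Set where
  field
    S       : Fin (size H) → Bool
    F       : Fin (size H) → Fin (size H) → Bool
    F-sym   : ∀ i j → F i j ≡ F j i
    F⊆adj   : ∀ i j → F i j ≡ true → adj H i j ≡ true
    F-in-S  : ∀ i j → F i j ≡ true → S i ≡ true
open Subgraph public

Degenerate : Graph → ℕ → Set
Degenerate H k = (G : Subgraph H) → (∃[ v ] S G v ≡ true) →
                 ∃[ v ] (S G v ≡ true × countFin (F G v) ≤ k)

IsDegeneracy : Graph → ℕ → Set
IsDegeneracy H d = Degenerate H d × (∀ k → Degenerate H k → d ≤ k)

-- A multigraph on [n] (= Fin n) as a list of edges (loops / repeats allowed).
Multigraph : ℕ → Set
Multigraph n = List (Fin n × Fin n)

HasCopy : (H : Graph) → {n : ℕ} → Multigraph n → Set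
HasCopy H {n} G = Σ (Fin (size H) → Fin n) λ φ → (Injective _≡_ _≡_ φ ×
  (∀ i j → adj H i j ≡ true → ((φ i , φ j) ∈ G ⊎ (φ j , φ i) ∈ G)))

-- A (deterministic, given a fixed random seed) Builder strategy: given the
-- history v_{t-1},...,v_1 (most recent first) and the current v_t, choose u_t.
-- Builder's earlier choices are determined by these, so they need not be passed.
Strategy : ℕ → Set
Strategy n = List (Fin n) → Fin n → Fin n

-- the multigraph produced when the random vertices are v_1,...,v_m (head = v_1)
play : {n m : ℕ} → Strategy n → List (Fin n) → Vec (Fin n) m → Multigraph n
play σ hist []       = []
play σ hist (v ∷ vs) = (σ hist v , v) ∷ play σ (v ∷ hist) vs

countVec : (n m : ℕ) → (Vec (Fin n) m → Bool) → ℕ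
countVec n zero    p = if p [] then 1 else 0
countVec n (suc m) p = sum (map (λ i → countVec n m (λ vs → p (i ∷ vs))) (allFin n))

goodCount : (n m s : ℕ) → (Fin (suc s) → Vec (Fin n) m → Bool) → ℕ
goodCount n m s good = sum (map (λ r → countVec n m (good r)) (allFin (suc s)))

-- total number of equally likely outcomes: (s+1) · n^m
totalCount : (n m s : ℕ) → ℕ
totalCount n m s = suc s * n ^ m

module Submission where

-- Order V(H) so that each vertex has at most d
-- earlier neighbours (DegeneracyOrder) and embed the vertices one at a time.  With
-- B = ⌊n^{1/d}⌋ (root), a vertex x is embedded in d stages: in the first Builder
-- catches B^{d-1} unused arrivals, joining each to the first back-image of x; in each
-- later stage he catches B^{r} arrivals among the previous catch, joining them to the
-- next back-image; the last catch is joined to every back-image and becomes the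
-- image of x (Builder, Correctness).
--
-- A catch in stage r is given cost 2^{d+1} B^{e-r} (e = d-1), and the
-- potential W of a state is the total cost still to pay, W₀ = O(B^e).  In every state
-- so many arrivals make progress that W drops by one in expectation (Running), and
-- an averaging lemma over the n^m arrival sequences (Process.Averaging) shows that
-- at most a W₀/m fraction of them leave the machine unfinished.  Since m ≫ B^e this
-- fraction vanishes (Construction).

open import Defs renaming (sym to adj-sym)

open import Data.Bool using (Bool; true; false; if_then_else_; _∧_; _∨_; not)
open import Data.Bool.Properties using (T-≡) renaming (_≟_ to _≟ᵇ_)
open import Data.Empty using (⊥-elim)
open import Data.Fin using (Fin) renaming (zero to fzero; suc to fsuc)
open import Data.Fin.Properties using (_≟_; any?)
open import Data.List using (List; []; _∷_; [_]; map; allFin; length; _++_; _ʳ++_; filterᵇ; head; take; drop)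
open import Data.List.Membership.Propositional using (_∈_; _∉_)
open import Data.List.Membership.Propositional.Properties using (∈-filter⁺; ∈-filter⁻; ∈-++⁺ˡ; ∈-++⁺ʳ; ∈-++⁻; ∈-map⁺)
import Data.List.Membership.DecPropositional as DecMembership
open import Data.List.Properties using (map-tabulate; map-cong; ++-assoc; take++drop≡id; length-drop; length-map)
open import Data.List.Relation.Unary.All as All using (lookup)
open import Data.List.Relation.Unary.All.Properties using (¬Any⇒All¬)
open import Data.List.Relation.Unary.Any using (here; there; toSum)
open import Data.List.Relation.Unary.Unique.Propositional using (Unique; []; _∷_)
import Data.List.Relation.Unary.Unique.Propositional.Properties as Unique
open import Data.Maybe using (fromMaybe)
open import Data.Nat using (ℕ; zero; suc; _+_; _*_; _∸_; _^_; _≤_; _<_; z≤n; s≤s; s≤s⁻¹; _≤?_; _<?_; NonZero)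
import Data.Nat as ℕ
open import Data.Nat.ListAction using (sum)
open import Data.Nat.Properties hiding (_≟_)
open import Data.Nat.Tactic.RingSolver using (solve-∀)
open import Data.Product using (Σ; _×_; _,_; ∃-syntax; proj₁; proj₂)
open import Data.Sum using (_⊎_; inj₁; inj₂; [_,_]′) renaming (map₂ to ⊎-map₂)
open import Data.Unit using (⊤; tt)
open import Data.Vec using (Vec; []; _∷_)
open import Function using (_∘_; id)
open import Function.Bundles using (Equivalence)
open import Relation.Binary.PropositionalEquality
  using (_≡_; refl; sym; trans; cong; cong₂; subst; module ≡-Reasoning)
open import Relation.Nullary using (¬_; yes; no; contradiction)
open import Relation.Nullary.Decidable using (Dec; does; dec-true; dec-false; T?)

∑ : {k : ℕ} → (Fin k → ℕ) → ℕ
∑ {k} f = sum (map f (allFin k))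

∑-suc : ∀ {k} (f : Fin (suc k) → ℕ) → ∑ f ≡ f fzero + ∑ (f ∘ fsuc)
∑-suc f = cong (f fzero +_) (cong sum
  (trans (map-tabulate fsuc f) (sym (map-tabulate id (f ∘ fsuc)))))

∑-cong : ∀ {k} {f g : Fin k → ℕ} → (∀ i → f i ≡ g i) → ∑ f ≡ ∑ g
∑-cong {k} e = cong sum (map-cong e (allFin k))

∑-mono : ∀ {k} {f g : Fin k → ℕ} → (∀ i → f i ≤ g i) → ∑ f ≤ ∑ g
∑-mono {zero}  le = z≤n
∑-mono {suc k} {f} {g} le
  rewrite ∑-suc f | ∑-suc g = +-mono-≤ (le fzero) (∑-mono (le ∘ fsuc))

∑-+ : ∀ {k} (f g : Fin k → ℕ) → ∑ (λ i → f i + g i) ≡ ∑ f + ∑ g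
∑-+ {zero}  f g = refl
∑-+ {suc k} f g = begin
  ∑ (λ i → f i + g i)                               ≡⟨ ∑-suc (λ i → f i + g i) ⟩
  (f fzero + g fzero) + ∑ (λ i → f (fsuc i) + g (fsuc i))
    ≡⟨ cong ((f fzero + g fzero) +_) (∑-+ (f ∘ fsuc) (g ∘ fsuc)) ⟩
  (f fzero + g fzero) + (∑ (f ∘ fsuc) + ∑ (g ∘ fsuc))
    ≡⟨ interchange (f fzero) (g fzero) (∑ (f ∘ fsuc)) (∑ (g ∘ fsuc)) ⟩
  (f fzero + ∑ (f ∘ fsuc)) + (g fzero + ∑ (g ∘ fsuc)) ≡⟨ sym (cong₂ _+_ (∑-suc f) (∑-suc g)) ⟩
  ∑ f + ∑ g                                         ∎
  where
  open ≡-Reasoning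
  interchange : ∀ a b c d → (a + b) + (c + d) ≡ (a + c) + (b + d)
  interchange = solve-∀

∑-*ˡ : ∀ {k} (c : ℕ) (f : Fin k → ℕ) → ∑ (λ i → c * f i) ≡ c * ∑ f
∑-*ˡ {zero}  c f = sym (*-zeroʳ c)
∑-*ˡ {suc k} c f rewrite ∑-suc (λ i → c * f i) | ∑-suc f | ∑-*ˡ c (f ∘ fsuc) =
  sym (*-distribˡ-+ c (f fzero) (∑ (f ∘ fsuc)))

∑-const : ∀ {k} (c : ℕ) → ∑ {k} (λ _ → c) ≡ k * c
∑-const {zero}  c = refl
∑-const {suc k} c = trans (∑-suc {k} (λ _ → c)) (cong (c +_) (∑-const {k} c))

-- The indicator of a boolean; countFin f is literally ∑ (χ ∘ f).
χ : Bool → ℕ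
χ b = if b then 1 else 0

χ-split : ∀ a b → χ a ≤ χ (a ∧ not b) + χ b
χ-split true  true  = s≤s z≤n
χ-split true  false = s≤s z≤n
χ-split false b     = z≤n

χ-neither : ∀ a b → 1 ≤ χ (not a ∧ not b) + χ (a ∨ b)
χ-neither true  b     = s≤s z≤n
χ-neither false true  = s≤s z≤n
χ-neither false false = s≤s z≤n

χ-∨ : ∀ a b → χ (a ∨ b) ≤ χ a + χ b
χ-∨ true  b = s≤s z≤n
χ-∨ false b = ≤-refl

χ-not : ∀ a → χ a + χ (not a) ≡ 1
χ-not true  = refl
χ-not false = refl

count-cover : ∀ {k} {f g h : Fin k → Bool} →
  (∀ i → χ (f i) ≤ χ (g i) + χ (h i)) → countFin f ≤ countFin g + countFin h
count-cover {g = g} {h} le = ≤-trans (∑-mono le) (≤-reflexive (∑-+ (χ ∘ g) (χ ∘ h)))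

count-split : ∀ {k} {f g h : Fin k → Bool} →
  (∀ i → χ (g i) + χ (h i) ≤ χ (f i)) → countFin g + countFin h ≤ countFin f
count-split {g = g} {h} le = ≤-trans (≤-reflexive (sym (∑-+ (χ ∘ g) (χ ∘ h)))) (∑-mono le)

count-all : ∀ k → countFin {k} (λ _ → true) ≡ k
count-all k = trans (∑-const {k} 1) (*-identityʳ k)

count-none : ∀ k → countFin {k} (λ _ → false) ≡ 0
count-none k = trans (∑-const {k} 0) (*-zeroʳ k)

count-≟ : ∀ {k} (a : Fin k) → countFin (λ v → does (v ≟ a)) ≡ 1
count-≟ {suc k} fzero    = trans (∑-suc {k} (λ v → χ (does (v ≟ fzero)))) (cong suc (count-none k))
count-≟ {suc k} (fsuc a) = trans (∑-suc {k} (λ v → χ (does (v ≟ fsuc a)))) (count-≟ a)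

count-remove : ∀ {k} (f : Fin k → Bool) (a : Fin k) → f a ≡ true →
  suc (countFin (λ v → f v ∧ not (does (v ≟ a)))) ≤ countFin f
count-remove f a fa = ≤-trans (≤-reflexive (cong (_+ countFin f′) (sym (count-≟ a))))
                               (count-split pointwise)
  where
  f′ : Fin _ → Bool
  f′ v = f v ∧ not (does (v ≟ a))
  pointwise : ∀ v → χ (does (v ≟ a)) + χ (f′ v) ≤ χ (f v)
  pointwise v with v ≟ a
  ... | yes refl rewrite fa = ≤-refl
  ... | no _ with f v
  ...   | true  = ≤-refl
  ...   | false = ≤-refl

_∈?_ : ∀ {k} (v : Fin k) (l : List (Fin k)) → Dec (v ∈ l)
_∈?_ {k} = DecMembership._∈?_ (_≟_ {k})

count-∈≤length : ∀ {k} (l : List (Fin k)) → countFin (λ v → does (v ∈? l)) ≤ length l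
count-∈≤length {k} []      = ≤-reflexive (count-none k)
count-∈≤length     (a ∷ l) =
  ≤-trans (count-cover (λ v → χ-∨ (does (v ≟ a)) (does (v ∈? l))))
          (+-mono-≤ (≤-reflexive (count-≟ a)) (count-∈≤length l))

unique⇒length≤count : ∀ {k} {l : List (Fin k)} (f : Fin k → Bool) → Unique l →
  (∀ j → j ∈ l → f j ≡ true) → length l ≤ countFin f
unique⇒length≤count f [] _ = z≤n
unique⇒length≤count {l = a ∷ l} f (a∉l ∷ unique-l) l⊆f =
  ≤-trans (s≤s (unique⇒length≤count (λ v → f v ∧ not (does (v ≟ a))) unique-l l⊆f′))
          (count-remove f a (l⊆f a (here refl)))
  where
  l⊆f′ : ∀ j → j ∈ l → f j ∧ not (does (j ≟ a)) ≡ true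
  l⊆f′ j j∈l with j ≟ a
  ... | yes refl = ⊥-elim (lookup a∉l j∈l refl)
  ... | no _ rewrite l⊆f j (there j∈l) = refl

count-∈ : ∀ {k} (l : List (Fin k)) → Unique l → length l ≤ countFin (λ v → does (v ∈? l))
count-∈ l unique-l = unique⇒length≤count _ unique-l (λ j j∈l → dec-true (j ∈? l) j∈l)

countVec-cong : ∀ n m {p q : Vec (Fin n) m → Bool} → (∀ vs → p vs ≡ q vs) →
  countVec n m p ≡ countVec n m q
countVec-cong n zero    e rewrite e [] = refl
countVec-cong n (suc m) e = ∑-cong (λ i → countVec-cong n m (λ vs → e (i ∷ vs)))

countVec-complement : ∀ n m (p : Vec (Fin n) m → Bool) →
  countVec n m p + countVec n m (not ∘ p) ≡ n ^ m
countVec-complement n zero    p = χ-not (p [])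
countVec-complement n (suc m) p = begin
  countVec n (suc m) p + countVec n (suc m) (not ∘ p)
    ≡⟨ sym (∑-+ (λ i → countVec n m (λ vs → p (i ∷ vs)))
                (λ i → countVec n m (λ vs → not (p (i ∷ vs))))) ⟩
  ∑ (λ i → countVec n m (λ vs → p (i ∷ vs)) + countVec n m (λ vs → not (p (i ∷ vs))))
    ≡⟨ ∑-cong (λ i → countVec-complement n m (λ vs → p (i ∷ vs))) ⟩
  ∑ {n} (λ _ → n ^ m)                                    ≡⟨ ∑-const {n} (n ^ m) ⟩
  n ^ suc m                                              ∎
  where open ≡-Reasoning

countVec≤ : ∀ n m (p : Vec (Fin n) m → Bool) → countVec n m p ≤ n ^ m
countVec≤ n m p = ≤-trans (m≤m+n _ _) (≤-reflexive (countVec-complement n m p))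

countVec-none : ∀ n m → countVec n m (λ _ → false) ≡ 0
countVec-none n zero    = refl
countVec-none n (suc m) = trans (∑-cong {n} (λ _ → countVec-none n m)) (count-none n)

module Process {St : Set} {n : ℕ} (step : St → Fin n → St) (finished : St → Bool) where

  run : ∀ {m} → St → Vec (Fin n) m → St
  run s []       = s
  run s (v ∷ vs) = run (step s v) vs

  unfinished : ℕ → St → ℕ
  unfinished m s = countVec n m (λ vs → not (finished (run s vs)))

  -- Suppose finished states stay finished, and a potential W
  -- drops by at least one in expectation at every unfinished state satisfying an
  -- invariant Inv.  Then Pr[not finished after m rounds] ≤ W(s)/m, i.e.
  -- m · unfinished m s ≤ W s · n^m.
  module Averaging
    (Inv : St → Set) (W : St → ℕ)
    (inv-step  : ∀ s v → Inv s → Inv (step s v))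
    (absorbing : ∀ s v → finished s ≡ true → finished (step s v) ≡ true)
    (drift     : ∀ s → Inv s → finished s ≡ false → ∑ (λ v → W (step s v)) + n ≤ n * W s)
    where

    finished-run : ∀ {m} s (vs : Vec (Fin n) m) → finished s ≡ true → finished (run s vs) ≡ true
    finished-run s []       fin = fin
    finished-run s (v ∷ vs) fin = finished-run (step s v) vs (absorbing s v fin)

    averaging : ∀ m s → Inv s → m * unfinished m s ≤ W s * n ^ m
    averaging zero    s I = z≤n
    averaging (suc m) s I with finished s in fin
    ... | true = ≤-trans (≤-reflexive (trans (cong (suc m *_) none-unfinished) (*-zeroʳ (suc m))))
                         z≤n
      where
      none-unfinished : unfinished (suc m) s ≡ 0
      none-unfinished = trans
        (countVec-cong n (suc m) (λ vs → cong not (finished-run s vs fin)))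
        (countVec-none n (suc m))
    ... | false = begin
      suc m * ∑ U                              ≡⟨ sym (∑-*ˡ (suc m) U) ⟩
      ∑ (λ v → suc m * U v)                    ≤⟨ ∑-mono each ⟩
      ∑ (λ v → n ^ m + n ^ m * W (step s v))   ≡⟨ ∑-+ (λ _ → n ^ m) (λ v → n ^ m * W (step s v)) ⟩
      ∑ {n} (λ _ → n ^ m) + ∑ (λ v → n ^ m * W (step s v))
        ≡⟨ cong₂ _+_ (∑-const {n} (n ^ m)) (∑-*ˡ (n ^ m) (λ v → W (step s v))) ⟩
      n * n ^ m + n ^ m * ∑W                   ≡⟨ regroup n (n ^ m) ∑W ⟩
      (∑W + n) * n ^ m                         ≤⟨ *-monoˡ-≤ (n ^ m) (drift s I fin) ⟩
      n * W s * n ^ m                          ≡⟨ regroup′ n (W s) (n ^ m) ⟩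
      W s * n ^ suc m                          ∎
      where
      open ≤-Reasoning
      U : Fin n → ℕ
      U v = unfinished m (step s v)
      ∑W : ℕ
      ∑W = ∑ (λ v → W (step s v))
      -- after the first arrival v: at most all n^m continuations, and induction
      each : ∀ v → suc m * U v ≤ n ^ m + n ^ m * W (step s v)
      each v = +-mono-≤ (countVec≤ n m _)
        (≤-trans (averaging m (step s v) (inv-step s v I)) (≤-reflexive (*-comm _ (n ^ m))))
      regroup : ∀ n x y → n * x + x * y ≡ (y + n) * x
      regroup = solve-∀
      regroup′ : ∀ n w x → n * w * x ≡ w * (n * x)
      regroup′ = solve-∀

^-distribʳ-* : ∀ a b k → (a * b) ^ k ≡ a ^ k * b ^ k
^-distribʳ-* a b zero    = refl
^-distribʳ-* a b (suc k) rewrite ^-distribʳ-* a b k = interchange a b (a ^ k) (b ^ k)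
  where
  interchange : ∀ a b x y → a * b * (x * y) ≡ a * x * (b * y)
  interchange = solve-∀

^-cancelʳ-< : ∀ d {a b} → a ^ d < b ^ d → a < b
^-cancelʳ-< d {a} {b} lt with a <? b
... | yes a<b = a<b
... | no  a≮b = contradiction (^-monoˡ-≤ d (≮⇒≥ a≮b)) (<⇒≱ lt)

^-cancelʳ-≤ : ∀ d .{{_ : NonZero d}} {a b} → a ^ d ≤ b ^ d → a ≤ b
^-cancelʳ-≤ d {a} {b} le with a ≤? b
... | yes a≤b = a≤b
... | no  a≰b = contradiction (^-monoˡ-< d (≰⇒> a≰b)) (≤⇒≯ le)

-- root d n = ⌊n^{1/d}⌋, computed incrementally: root d (n+1) is root d n or one more.
root : ℕ → ℕ → ℕ
root d zero    = 0
root d (suc n) with suc (root d n) ^ d ≤? suc n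
... | yes _ = suc (root d n)
... | no  _ = root d n

root-bounds : ∀ e n → root (suc e) n ^ suc e ≤ n × n < suc (root (suc e) n) ^ suc e
root-bounds e zero = z≤n , ≤-trans (s≤s z≤n) (≤-reflexive (sym (^-zeroˡ (suc e))))
root-bounds e (suc n) with root-bounds e n | suc (root (suc e) n) ^ suc e ≤? suc n
... | _ , upper | yes grows = grows , ≤-trans (s≤s upper) (^-monoˡ-< (suc e) (n<1+n _))
... | lower , _ | no  stays = m≤n⇒m≤1+n lower , ≰⇒> stays

root-lower : ∀ e n → root (suc e) n ^ suc e ≤ n
root-lower e n = proj₁ (root-bounds e n)

root-upper : ∀ e n → n < suc (root (suc e) n) ^ suc e
root-upper e n = proj₂ (root-bounds e n)

root-≥2 : ∀ e n → 2 ^ suc e ≤ n → 2 ≤ root (suc e) n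
root-≥2 e n le = s≤s⁻¹ (^-cancelʳ-< (suc e) (≤-<-trans le (root-upper e n)))

∧-intro : ∀ {a b} → a ≡ true → b ≡ true → a ∧ b ≡ true
∧-intro refl refl = refl

∧-elim : ∀ {a b} → a ∧ b ≡ true → a ≡ true × b ≡ true
∧-elim {true} {true} refl = refl , refl

does⇒ : ∀ {P : Set} (P? : Dec P) → does P? ≡ true → P
does⇒ (yes p) _ = p

false-does⇒ : ∀ {P : Set} (P? : Dec P) → does P? ≡ false → ¬ P
false-does⇒ (no ¬p) _ = ¬p

not-does⇒ : ∀ {P : Set} (P? : Dec P) → not (does P?) ≡ true → ¬ P
not-does⇒ (no ¬p) _ = ¬p

take-1-short : ∀ {A : Set} (xs : List A) → length xs ≤ 1 → take 1 xs ≡ xs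
take-1-short []          _         = refl
take-1-short (_ ∷ [])    _         = refl
take-1-short (_ ∷ _ ∷ _) (s≤s ())

quarter-bound : ∀ n q a c → n ≤ q + (a + c) → 4 * a ≤ n → 2 * c ≤ n → n ≤ 4 * q
quarter-bound n q a c n≤ 4a≤n 2c≤n = +-cancelʳ-≤ (3 * n) n (4 * q) (begin
  n + 3 * n                         ≡⟨ solve₁ n ⟩
  4 * n                             ≤⟨ *-monoʳ-≤ 4 n≤ ⟩
  4 * (q + (a + c))                 ≡⟨ solve₂ q a c ⟩
  4 * q + (4 * a + 2 * (2 * c))     ≤⟨ +-monoʳ-≤ (4 * q) (+-mono-≤ 4a≤n (*-monoʳ-≤ 2 2c≤n)) ⟩
  4 * q + (n + 2 * n)               ≡⟨ solve₃ q n ⟩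
  4 * q + 3 * n                     ∎)
  where
  open ≤-Reasoning
  solve₁ : ∀ n → n + 3 * n ≡ 4 * n
  solve₁ = solve-∀
  solve₂ : ∀ q a c → 4 * (q + (a + c)) ≡ 4 * q + (4 * a + 2 * (2 * c))
  solve₂ = solve-∀
  solve₃ : ∀ q n → 4 * q + (n + 2 * n) ≡ 4 * q + 3 * n
  solve₃ = solve-∀

induced : (H : Graph) → (Fin (size H) → Bool) → Subgraph H
induced H T = record
  { S = T ; F = λ i j → T i ∧ (T j ∧ adj H i j)
  ; F-sym = F-sym′ ; F⊆adj = F⊆adj′ ; F-in-S = F-in-S′ }
  where
  F-sym′ : ∀ i j → T i ∧ (T j ∧ adj H i j) ≡ T j ∧ (T i ∧ adj H j i)
  F-sym′ i j rewrite adj-sym H i j with T i | T j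
  ... | true  | true  = refl
  ... | true  | false = refl
  ... | false | true  = refl
  ... | false | false = refl
  F⊆adj′ : ∀ i j → T i ∧ (T j ∧ adj H i j) ≡ true → adj H i j ≡ true
  F⊆adj′ i j e with T i | T j
  ... | true  | true = e
  F⊆adj′ i j () | true  | false
  F⊆adj′ i j () | false | _
  F-in-S′ : ∀ i j → T i ∧ (T j ∧ adj H i j) ≡ true → T i ≡ true
  F-in-S′ i j e with T i
  ... | true = refl
  F-in-S′ i j () | false

module DegeneracyOrder (H : Graph) (d : ℕ) where

  V : Set
  V = Fin (size H)

  backDegree : V → List V → ℕ
  backDegree x D = length (filterᵇ (adj H x) D)

  backDegree-∷ : ∀ x a D → backDegree x (a ∷ D) ≡ χ (adj H x a) + backDegree x D
  backDegree-∷ x a D with adj H x a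
  ... | true  = refl
  ... | false = refl

  backDegree-ʳ++ : ∀ x l D → backDegree x (l ʳ++ D) ≡ backDegree x l + backDegree x D
  backDegree-ʳ++ x []      D = refl
  backDegree-ʳ++ x (a ∷ l) D = begin
    backDegree x (l ʳ++ (a ∷ D))                ≡⟨ backDegree-ʳ++ x l (a ∷ D) ⟩
    backDegree x l + backDegree x (a ∷ D)       ≡⟨ cong (backDegree x l +_) (backDegree-∷ x a D) ⟩
    backDegree x l + (χ (adj H x a) + backDegree x D)
      ≡⟨ sym (+-assoc (backDegree x l) (χ (adj H x a)) (backDegree x D)) ⟩
    (backDegree x l + χ (adj H x a)) + backDegree x D
      ≡⟨ cong (_+ backDegree x D) (+-comm (backDegree x l) (χ (adj H x a))) ⟩
    (χ (adj H x a) + backDegree x l) + backDegree x D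
      ≡⟨ cong (_+ backDegree x D) (sym (backDegree-∷ x a l)) ⟩
    backDegree x (a ∷ l) + backDegree x D       ∎
    where open ≡-Reasoning

  -- `Admissible D l`: going through l from left to right, every vertex has at most
  -- d neighbours among the vertices before it (and those of D, the most recent first).
  Admissible : List V → List V → Set
  Admissible D []      = ⊤
  Admissible D (x ∷ l) = backDegree x D ≤ d × Admissible (x ∷ D) l

  admissible-snoc : ∀ D l v → Admissible D l → backDegree v (l ʳ++ D) ≤ d →
                    Admissible D (l ++ [ v ])
  admissible-snoc D []      v _          deg = deg , tt
  admissible-snoc D (a ∷ l) v (degₐ , ok) deg = degₐ , admissible-snoc (a ∷ D) l v ok deg

  record Ordering (T : V → Bool) : Set where
    field
      order      : List V
      admissible : Admissible [] order
      complete   : ∀ i → T i ≡ true → i ∈ order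
      sound      : ∀ i → i ∈ order → T i ≡ true
      unique     : Unique order

  _∖_ : (V → Bool) → V → V → Bool
  (T ∖ v) j = T j ∧ not (does (j ≟ v))

  ∖⊆ : ∀ T v j → (T ∖ v) j ≡ true → T j ≡ true
  ∖⊆ T v j e with T j
  ... | true = refl
  ∖⊆ T v j () | false

  append-ordering : ∀ T v → T v ≡ true → countFin (F (induced H T) v) ≤ d →
                    Ordering (T ∖ v) → Ordering T
  append-ordering T v Tv deg-v R = record
    { order = o ++ [ v ] ; admissible = admissible′ ; complete = complete′
    ; sound = sound′ ; unique = unique′ }
    where
    open Ordering R renaming (order to o)

    v∉o : ¬ v ∈ o
    v∉o v∈o with sound v v∈o
    ... | v∈T∖v rewrite dec-true (v ≟ v) refl | Tv with () ← v∈T∖v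

    -- v's neighbours in o are distinct neighbours of v inside T
    back-v : backDegree v o ≤ d
    back-v = ≤-trans (unique⇒length≤count _ (Unique.filter⁺ _ unique) in-F) deg-v
      where
      in-F : ∀ j → j ∈ filterᵇ (adj H v) o → T v ∧ (T j ∧ adj H v j) ≡ true
      in-F j j∈ with ∈-filter⁻ (T? ∘ adj H v) {xs = o} j∈
      ... | j∈o , vj = ∧-intro Tv (∧-intro (∖⊆ T v j (sound j j∈o)) (Equivalence.to T-≡ vj))

    admissible′ : Admissible [] (o ++ [ v ])
    admissible′ = admissible-snoc [] o v admissible
      (≤-trans (≤-reflexive (trans (backDegree-ʳ++ v o []) (+-identityʳ _))) back-v)

    complete′ : ∀ i → T i ≡ true → i ∈ o ++ [ v ]
    complete′ i Ti with i ≟ v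
    ... | yes refl = ∈-++⁺ʳ o (here refl)
    ... | no  i≢v  = ∈-++⁺ˡ (complete i (∧-intro Ti (cong not (dec-false (i ≟ v) i≢v))))

    sound′ : ∀ i → i ∈ o ++ [ v ] → T i ≡ true
    sound′ i i∈ with ∈-++⁻ o i∈
    ... | inj₁ i∈o         = ∖⊆ T v i (sound i i∈o)
    ... | inj₂ (here refl) = Tv

    unique′ : Unique (o ++ [ v ])
    unique′ = Unique.++⁺ unique (All.[] ∷ []) λ { (v∈o , here refl) → v∉o v∈o }

  -- If H is d-degenerate, every vertex set T has an admissible ordering: order
  -- T ∖ v first, for a vertex v of degree ≤ d in H[T] (induction on |T| ≤ k).
  ordering : Degenerate H d → ∀ k (T : V → Bool) → countFin T ≤ k → Ordering T
  ordering degenerate k T |T|≤k with any? (λ i → T i ≟ᵇ true)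
  ... | no empty = record
    { order = [] ; admissible = tt ; complete = λ i Ti → ⊥-elim (empty (i , Ti))
    ; sound = λ i () ; unique = [] }
  ... | yes nonempty with degenerate (induced H T) nonempty
  ...   | v , Tv , deg-v = append-ordering T v Tv deg-v (rest k |T|≤k)
    where
    rest : ∀ k → countFin T ≤ k → Ordering (T ∖ v)
    rest zero    |T|≤0 = contradiction (≤-trans (count-remove T v Tv) |T|≤0) λ ()
    rest (suc k) |T|≤k = ordering degenerate k (T ∖ v) (s≤s⁻¹ (≤-trans (count-remove T v Tv) |T|≤k))

-- To embed x, whose embedded neighbours have images
-- t₀,…,t_{j} (j ≤ e), Builder goes through stages e, e-1, …, 0.  In stage r he
-- catches B^r distinct candidates: in stage e every unused vertex is a candidate,
-- later only the catch of the previous stage is; a caught vertex is joined to the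
-- current target, and each stage after the first moves to the next target.  The
-- single vertex caught in stage 0 is joined to all tᵢ and becomes the image of x.
module Builder (H : Graph) (e n B : ℕ) where
  open DegeneracyOrder H (suc e) public

  -- a partial embedding: pairs (x , image of x)
  Embedding : Set
  Embedding = List (V × Fin n)

  record Phase : Set where
    constructor phase
    field
      emb     : Embedding
      vertex  : V
      todo    : List V
      stage   : ℕ
      targets : List (Fin n)  -- back-images still to be joined, current one first
      fresh   : Bool          -- is this the first stage?
      pool    : List (Fin n)  -- the candidates of a later stage
      caught  : List (Fin n)

  data State : Set where
    done : Embedding → State
    busy : Phase → State

  images : Embedding → List (Fin n)
  images = map proj₂

  keys : Embedding → List V
  keys = map proj₁

  backImages : V → Embedding → List (Fin n)
  backImages x emb = map proj₂ (filterᵇ (adj H x ∘ proj₁) emb)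

  startPhase : Embedding → List V → State
  startPhase emb []         = done emb
  startPhase emb (x ∷ todo) = busy (phase emb x todo e (backImages x emb) true [] [])

  candidate : Phase → Fin n → Bool
  candidate (phase emb _ _ _ _ true  _    _) v = not (does (v ∈? images emb))
  candidate (phase _   _ _ _ _ false pool _) v = does (v ∈? pool)

  progress : Phase → Fin n → Bool
  progress p v = candidate p v ∧ not (does (v ∈? Phase.caught p))

  completes : Phase → Bool
  completes p = does (suc (length (Phase.caught p)) ℕ.≟ B ^ Phase.stage p)

  advance : Bool → Phase → Fin n → State
  advance false (phase emb x todo r ts f pool caught) v = busy (phase emb x todo r ts f pool (v ∷ caught))
  advance true  (phase emb x todo zero ts _ _ _) v = startPhase ((x , v) ∷ emb) todo
  advance true  (phase emb x todo (suc r) ts _ _ caught) v =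
    busy (phase emb x todo r (drop 1 ts) false (v ∷ caught) [])

  react : Bool → Phase → Fin n → State
  react false p v = busy p
  react true  p v = advance (completes p) p v

  step : State → Fin n → State
  step (done emb) v = done emb
  step (busy p)   v = react (progress p v) p v

  finished : State → Bool
  finished (done _) = true
  finished (busy _) = false

  -- Builder joins a progressing arrival to the current target (other arrivals get a loop)
  choice : State → Fin n → Fin n
  choice (done _) v = v
  choice (busy p) v = if progress p v then fromMaybe v (head (Phase.targets p)) else v

  open Process step finished public

  trace : ∀ {m} → State → Vec (Fin n) m → Multigraph n
  trace s []       = []
  trace s (v ∷ vs) = (choice s v , v) ∷ trace (step s v) vs

  -- the state reached from s₀ after the arrivals hist (most recent first)
  after : State → List (Fin n) → State
  after s₀ []         = s₀
  after s₀ (w ∷ hist) = step (after s₀ hist) w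

  strategy : State → Strategy n
  strategy s₀ hist v = choice (after s₀ hist) v

  play≡trace : ∀ s₀ hist {m} (vs : Vec (Fin n) m) →
               play (strategy s₀) hist vs ≡ trace (after s₀ hist) vs
  play≡trace s₀ hist []       = refl
  play≡trace s₀ hist (v ∷ vs) = cong (_ ∷_) (play≡trace s₀ (v ∷ hist) vs)

  backImages-length : ∀ x emb → length (backImages x emb) ≡ backDegree x (keys emb)
  backImages-length x []              = refl
  backImages-length x ((a , α) ∷ emb) with adj H x a
  ... | true  = cong suc (backImages-length x emb)
  ... | false = backImages-length x emb

  backImages-∈ : ∀ {x b β} emb → (b , β) ∈ emb → adj H x b ≡ true → β ∈ backImages x emb
  backImages-∈ {x} emb bβ∈ xb =
    ∈-map⁺ proj₂ (∈-filter⁺ (T? ∘ adj H x ∘ proj₁) bβ∈ (Equivalence.from T-≡ xb))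

  module Correctness (G : Multigraph n) where

    Joined : Fin n → Fin n → Set
    Joined α β = (α , β) ∈ G ⊎ (β , α) ∈ G

    Homomorphic : Embedding → Set
    Homomorphic emb = ∀ {a α b β} → (a , α) ∈ emb → (b , β) ∈ emb → adj H a b ≡ true → Joined α β

    InjectiveEmb : Embedding → Set
    InjectiveEmb emb = ∀ {a α b β} → (a , α) ∈ emb → (b , β) ∈ emb → α ≡ β → a ≡ b

    Embeds : Embedding → V → Set
    Embeds emb i = Σ (Fin n) λ α → (i , α) ∈ emb

    JoinedToAll : List (Fin n) → Fin n → Set
    JoinedToAll ts w = ∀ {t} → t ∈ ts → Joined t w

    JoinedToHead : List (Fin n) → Fin n → Set
    JoinedToHead []      w = ⊤
    JoinedToHead (t ∷ _) w = Joined t w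

    Catchable : Embedding → List (Fin n) → List (Fin n) → Fin n → Set
    Catchable emb ls ts w = w ∉ images emb × JoinedToAll ls w × JoinedToHead ts w

    -- During a phase the embedding so far is a copy; the back-images of the current
    -- vertex split into those already dealt with (linked) and the remaining targets,
    -- at most one per remaining stage; pool and catch are catchable.
    module _ (p : Phase) where
      open Phase p

      record PhaseInv : Set where
        field
          hom            : Homomorphic emb
          inj            : InjectiveEmb emb
          covers         : ∀ i → Embeds emb i ⊎ (i ≡ vertex ⊎ i ∈ todo)
          admissible     : Admissible (keys emb) (vertex ∷ todo)
          few-targets    : length targets ≤ suc stage
          linked         : List (Fin n)
          split          : linked ++ targets ≡ backImages vertex emb
          fresh-unlinked : fresh ≡ true → linked ≡ []
          pool-ok        : fresh ≡ false → ∀ {w} → w ∈ pool →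
                           w ∉ images emb × JoinedToAll linked w
          caught-ok      : ∀ {w} → w ∈ caught → Catchable emb linked targets w

    Invariant : State → Set
    Invariant (done emb) = Homomorphic emb × InjectiveEmb emb × (∀ i → Embeds emb i)
    Invariant (busy p)   = PhaseInv p

    Joined-sym : ∀ {α β} → Joined α β → Joined β α
    Joined-sym (inj₁ αβ) = inj₂ αβ
    Joined-sym (inj₂ βα) = inj₁ βα

    start-inv : ∀ emb todo → Homomorphic emb → InjectiveEmb emb →
      (∀ i → Embeds emb i ⊎ i ∈ todo) → Admissible (keys emb) todo →
      Invariant (startPhase emb todo)
    start-inv emb []         hom inj cov _   = hom , inj , λ i → [ id , (λ ()) ]′ (cov i)
    start-inv emb (x ∷ todo) hom inj cov adm = record
      { hom = hom ; inj = inj ; covers = λ i → ⊎-map₂ toSum (cov i) ; admissible = adm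
      ; few-targets = ≤-trans (≤-reflexive (backImages-length x emb)) (proj₁ adm)
      ; linked = [] ; split = refl ; fresh-unlinked = λ _ → refl
      ; pool-ok = λ () ; caught-ok = λ () }

    joined-target : ∀ p v → progress p v ≡ true → (choice (busy p) v , v) ∈ G →
                    JoinedToHead (Phase.targets p) v
    joined-target p v prog edge =
      joined-head (Phase.targets p)
        (subst (λ b → ((if b then fromMaybe v (head (Phase.targets p)) else v) , v) ∈ G) prog edge)
      where
      joined-head : ∀ ts → (fromMaybe v (head ts) , v) ∈ G → JoinedToHead ts v
      joined-head []      _    = tt
      joined-head (t ∷ _) edge = inj₁ edge

    -- A progressing arrival is a candidate, hence unused and joined to all
    -- back-images dealt with so far: it is catchable.
    arrival : ∀ p v (I : PhaseInv p) → progress p v ≡ true → (choice (busy p) v , v) ∈ G →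
              Catchable (Phase.emb p) (PhaseInv.linked I) (Phase.targets p) v
    arrival p@(phase emb _ _ _ _ true _ _) v I prog edge =
      not-does⇒ (v ∈? images emb) (proj₁ (∧-elim prog)) ,
      (λ t∈ → nothing-in-[] (subst (_ ∈_) (PhaseInv.fresh-unlinked I refl) t∈)) ,
      joined-target p v prog edge
      where
      nothing-in-[] : ∀ {t} → t ∈ [] → Joined t v
      nothing-in-[] ()
    arrival p@(phase _ _ _ _ _ false pool _) v I prog edge =
      proj₁ pooled , proj₂ pooled , joined-target p v prog edge
      where
      v∈pool : v ∈ pool
      v∈pool = does⇒ (v ∈? pool) (proj₁ (∧-elim prog))
      pooled : v ∉ images (Phase.emb p) × JoinedToAll (PhaseInv.linked I) v
      pooled = PhaseInv.pool-ok I refl v∈pool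

    joined-next : ∀ {ls ts w} → JoinedToAll ls w → JoinedToHead ts w →
                  JoinedToAll (ls ++ take 1 ts) w
    joined-next {ls} {[]}    joined-ls _           t∈ with ∈-++⁻ ls t∈
    ... | inj₁ t∈ls = joined-ls t∈ls
    joined-next {ls} {_ ∷ _} joined-ls joined-head t∈ with ∈-++⁻ ls t∈
    ... | inj₁ t∈ls        = joined-ls t∈ls
    ... | inj₂ (here refl) = joined-head

    extend-copy : ∀ emb x v → Homomorphic emb → InjectiveEmb emb → v ∉ images emb →
      JoinedToAll (backImages x emb) v →
      Homomorphic ((x , v) ∷ emb) × InjectiveEmb ((x , v) ∷ emb)
    extend-copy emb x v hom inj unused back = hom′ , inj′
      where
      hom′ : Homomorphic ((x , v) ∷ emb)
      hom′ (here refl) (here refl) xx = contradiction (trans (sym xx) (irrefl H x)) λ ()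
      hom′ (here refl) (there bβ)  xb = Joined-sym (back (backImages-∈ emb bβ xb))
      hom′ (there aα)  (here refl) ax = back (backImages-∈ emb aα (trans (adj-sym H x _) ax))
      hom′ (there aα)  (there bβ)  ab = hom aα bβ ab
      inj′ : InjectiveEmb ((x , v) ∷ emb)
      inj′ (here refl) (here refl) _    = refl
      inj′ (here refl) (there bβ)  refl = ⊥-elim (unused (∈-map⁺ proj₂ bβ))
      inj′ (there aα)  (here refl) refl = ⊥-elim (unused (∈-map⁺ proj₂ aα))
      inj′ (there aα)  (there bβ)  eq   = inj aα bβ eq

    advance-inv : ∀ b p v (I : PhaseInv p) →
      Catchable (Phase.emb p) (PhaseInv.linked I) (Phase.targets p) v →
      Invariant (advance b p v)
    advance-inv false (phase emb x todo r ts f pool caught) v I catchable =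
      record
        { hom = hom ; inj = inj ; covers = covers ; admissible = admissible
        ; few-targets = few-targets ; linked = linked ; split = split
        ; fresh-unlinked = fresh-unlinked ; pool-ok = pool-ok
        ; caught-ok = λ { (here refl) → catchable ; (there w∈) → caught-ok w∈ } }
      where open PhaseInv I
    -- stage 0 is complete: v is joined to all back-images and becomes the image of x
    advance-inv true (phase emb x todo zero ts f pool caught) v I (unused , joined-ls , joined-head) =
      start-inv ((x , v) ∷ emb) todo (proj₁ extended) (proj₂ extended) covers′ (proj₂ admissible)
      where
      open PhaseInv I
      back : JoinedToAll (backImages x emb) v
      back = subst (λ l → JoinedToAll l v)
        (trans (cong (linked ++_) (take-1-short ts few-targets)) split)
        (joined-next joined-ls joined-head)
      extended : Homomorphic ((x , v) ∷ emb) × InjectiveEmb ((x , v) ∷ emb)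
      extended = extend-copy emb x v hom inj unused back
      covers′ : ∀ i → Embeds ((x , v) ∷ emb) i ⊎ i ∈ todo
      covers′ i with covers i
      ... | inj₁ (α , iα)    = inj₁ (α , there iα)
      ... | inj₂ (inj₁ refl) = inj₁ (v , here refl)
      ... | inj₂ (inj₂ i∈)   = inj₂ i∈
    -- stage r+1 is complete: stage r draws from its catch, aiming at the next target
    advance-inv true (phase emb x todo (suc r) ts f pool caught) v I catchable = record
      { hom = hom ; inj = inj ; covers = covers ; admissible = admissible
      ; few-targets = ≤-trans (≤-reflexive (length-drop 1 ts)) (∸-monoˡ-≤ 1 few-targets)
      ; linked = linked ++ take 1 ts
      ; split = trans (++-assoc linked (take 1 ts) (drop 1 ts))
                      (trans (cong (linked ++_) (take++drop≡id 1 ts)) split)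
      ; fresh-unlinked = λ ()
      ; pool-ok = λ _ → pooled
      ; caught-ok = λ () }
      where
      open PhaseInv I
      pooled : ∀ {w} → w ∈ v ∷ caught → w ∉ images emb × JoinedToAll (linked ++ take 1 ts) w
      pooled (here refl) = proj₁ catchable , joined-next (proj₁ (proj₂ catchable)) (proj₂ (proj₂ catchable))
      pooled (there w∈) with caught-ok w∈
      ... | unused , joined-ls , joined-head = unused , joined-next joined-ls joined-head

    step-inv : ∀ s v → Invariant s → (choice s v , v) ∈ G → Invariant (step s v)
    step-inv (done emb) v I _    = I
    step-inv (busy p)   v I edge = react-inv (progress p v) refl
      where
      react-inv : ∀ b → progress p v ≡ b → Invariant (react b p v)
      react-inv false _    = I
      react-inv true  prog = advance-inv (completes p) p v I (arrival p v I prog edge)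

    run-inv : ∀ {m} s (vs : Vec (Fin n) m) → Invariant s →
              (∀ {z} → z ∈ trace s vs → z ∈ G) → Invariant (run s vs)
    run-inv s []       I _       = I
    run-inv s (v ∷ vs) I trace⊆G =
      run-inv (step s v) vs (step-inv s v I (trace⊆G (here refl))) (trace⊆G ∘ there)

    copy : ∀ s → Invariant s → finished s ≡ true → HasCopy H G
    copy (done emb) (hom , inj , embeds) _ =
      (λ i → proj₁ (embeds i)) ,
      (λ {i} {j} eq → inj (proj₂ (embeds i)) (proj₂ (embeds j)) eq) ,
      (λ i j ij → hom (proj₂ (embeds i)) (proj₂ (embeds j)) ij)

  finished⇒copy : ∀ ord → Admissible [] ord → (∀ i → i ∈ ord) →
    ∀ {m} (vs : Vec (Fin n) m) → finished (run (startPhase [] ord) vs) ≡ true →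
    HasCopy H (trace (startPhase [] ord) vs)
  finished⇒copy ord adm complete vs fin =
    copy (run (startPhase [] ord) vs) (run-inv (startPhase [] ord) vs start id) fin
    where
    open Correctness (trace (startPhase [] ord) vs)
    start : Invariant (startPhase [] ord)
    start = start-inv [] ord (λ ()) (λ ()) (inj₂ ∘ complete) adm

  -- The running time.  A catch in stage r costs cost r = 2·2^d·B^{e-r}, so a whole
  -- stage costs Q = B^r · cost r = 2·2^d·B^e and a whole vertex d·Q.
  cost : ℕ → ℕ
  cost r = 2 * (2 ^ suc e * B ^ (e ∸ r))

  Q : ℕ
  Q = 2 * (2 ^ suc e * B ^ e)

  stage-cost : ∀ r → r ≤ e → B ^ r * cost r ≡ Q
  stage-cost r r≤e = begin
    B ^ r * (2 * (2 ^ suc e * B ^ (e ∸ r))) ≡⟨ regroup (B ^ r) (2 ^ suc e) (B ^ (e ∸ r)) ⟩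
    2 * (2 ^ suc e * (B ^ (e ∸ r) * B ^ r)) ≡⟨ cong (λ x → 2 * (2 ^ suc e * x)) (sym (^-distribˡ-+-* B (e ∸ r) r)) ⟩
    2 * (2 ^ suc e * B ^ (e ∸ r + r))       ≡⟨ cong (λ x → 2 * (2 ^ suc e * B ^ x)) (m∸n+n≡m r≤e) ⟩
    Q                                       ∎
    where
    open ≡-Reasoning
    regroup : ∀ a p b → a * (2 * (p * b)) ≡ 2 * (p * (b * a))
    regroup = solve-∀

  -- the potential: the total cost of the remaining catches
  W : State → ℕ
  W (done _) = 0
  W (busy (phase _ _ todo r _ _ _ caught)) =
    length todo * (suc e * Q) + (r * Q + (B ^ r ∸ length caught) * cost r)

  module Running (h : ℕ) (B≥2 : 2 ≤ B) (B^d≤n : B ^ suc e ≤ n) (n<[B+1]^d : n < suc B ^ suc e)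
                 (4h≤n : 4 * h ≤ n) where

    instance
      B-nonZero : NonZero B
      B-nonZero = ℕ.>-nonZero (≤-trans (s≤s z≤n) B≥2)

    B^-positive : ∀ k → 0 < B ^ k
    B^-positive k = m^n>0 B k

    cost≥4 : ∀ r → 4 ≤ cost r
    cost≥4 r = *-monoʳ-≤ 2 (*-mono-≤ (^-monoʳ-≤ 2 (s≤s (z≤n {e}))) (B^-positive (e ∸ r)))

    module _ (p : Phase) where
      open Phase p

      record Shape : Set where
        field
          stage≤e       : stage ≤ e
          caught-short  : length caught < B ^ stage
          caught-unique : Unique caught
          pool-shape    : fresh ≡ false → Unique pool × length pool ≡ B ^ suc stage
          sized         : length emb + suc (length todo) ≡ h

    WellShaped : State → Set
    WellShaped (done _) = ⊤
    WellShaped (busy p) = Shape p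

    start-shape : ∀ emb todo → length emb + length todo ≡ h → WellShaped (startPhase emb todo)
    start-shape emb []         _     = tt
    start-shape emb (x ∷ todo) sized = record
      { stage≤e = ≤-refl ; caught-short = B^-positive e ; caught-unique = []
      ; pool-shape = λ () ; sized = sized }

    advance-shape : ∀ b p v → Shape p → v ∉ Phase.caught p → completes p ≡ b →
                    WellShaped (advance b p v)
    advance-shape false (phase emb x todo r ts f pool caught) v S v∉ incomplete = record
      { stage≤e = stage≤e
      ; caught-short = ≤∧≢⇒< caught-short (false-does⇒ (_ ℕ.≟ _) incomplete)
      ; caught-unique = ¬Any⇒All¬ caught v∉ ∷ caught-unique
      ; pool-shape = pool-shape ; sized = sized }
      where open Shape S
    advance-shape true (phase emb x todo zero ts f pool caught) v S v∉ complete =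
      start-shape ((x , v) ∷ emb) todo (trans (sym (+-suc _ _)) (Shape.sized S))
    advance-shape true (phase emb x todo (suc r) ts f pool caught) v S v∉ complete = record
      { stage≤e = ≤-trans (n≤1+n r) stage≤e ; caught-short = B^-positive r ; caught-unique = []
      ; pool-shape = λ _ → ¬Any⇒All¬ caught v∉ ∷ caught-unique , does⇒ (_ ℕ.≟ _) complete
      ; sized = sized }
      where open Shape S

    step-shape : ∀ s v → WellShaped s → WellShaped (step s v)
    step-shape (done _) v _ = tt
    step-shape (busy p) v S = react-shape (progress p v) refl
      where
      react-shape : ∀ b → progress p v ≡ b → WellShaped (react b p v)
      react-shape false _    = S
      react-shape true  prog =
        advance-shape (completes p) p v S (not-does⇒ (v ∈? _) (proj₂ (∧-elim prog))) refl

    catch-cost : ∀ b p v → Shape p → completes p ≡ b →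
                 W (advance b p v) + cost (Phase.stage p) ≡ W (busy p)
    catch-cost false (phase emb x todo r ts f pool caught) v S _ = begin
      L + (r * Q + (B ^ r ∸ suc c) * cost r) + cost r  ≡⟨ pay-one L (r * Q) (B ^ r ∸ suc c) (cost r) ⟩
      L + (r * Q + suc (B ^ r ∸ suc c) * cost r)
        ≡⟨ cong (λ x → L + (r * Q + x * cost r)) (sym (+-∸-assoc 1 (Shape.caught-short S))) ⟩
      L + (r * Q + (B ^ r ∸ c) * cost r)               ∎
      where
      open ≡-Reasoning
      L = length todo * (suc e * Q)
      c = length caught
      pay-one : ∀ a b x k → a + (b + x * k) + k ≡ a + (b + suc x * k)
      pay-one = solve-∀
    catch-cost true (phase emb x [] zero ts f pool []) v S _ = last-vertex (cost 0)
      where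
      last-vertex : ∀ k → 0 + k ≡ 0 * (suc e * Q) + (0 * Q + 1 * k)
      last-vertex = solve-∀
    catch-cost true (phase emb x (x′ ∷ todo) zero ts f pool []) v S _ = begin
      length todo * (suc e * Q) + (e * Q + B ^ e * cost e) + cost 0
        ≡⟨ cong (λ y → length todo * (suc e * Q) + (e * Q + y) + cost 0) (stage-cost e ≤-refl) ⟩
      length todo * (suc e * Q) + (e * Q + Q) + cost 0 ≡⟨ next-vertex (length todo) e Q (cost 0) ⟩
      suc (length todo) * (suc e * Q) + (0 * Q + 1 * cost 0) ∎
      where
      open ≡-Reasoning
      next-vertex : ∀ t e Q k → t * (suc e * Q) + (e * Q + Q) + k ≡ suc t * (suc e * Q) + (0 * Q + 1 * k)
      next-vertex = solve-∀
    catch-cost true (phase emb x todo zero ts f pool (_ ∷ _)) v S ()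
    catch-cost true (phase emb x todo (suc r) ts f pool caught) v S complete = begin
      L + (r * Q + B ^ r * cost r) + cost (suc r)
        ≡⟨ cong (λ y → L + (r * Q + y) + cost (suc r)) (stage-cost r (≤-trans (n≤1+n r) (Shape.stage≤e S))) ⟩
      L + (r * Q + Q) + cost (suc r)               ≡⟨ next-stage L r Q (cost (suc r)) ⟩
      L + (suc r * Q + 1 * cost (suc r))
        ≡⟨ cong (λ y → L + (suc r * Q + y * cost (suc r))) (sym one-left) ⟩
      L + (suc r * Q + (B ^ suc r ∸ length caught) * cost (suc r)) ∎
      where
      open ≡-Reasoning
      L = length todo * (suc e * Q)
      next-stage : ∀ a r Q k → a + (r * Q + Q) + k ≡ a + (suc r * Q + 1 * k)
      next-stage = solve-∀
      one-left : B ^ suc r ∸ length caught ≡ 1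
      one-left = trans (cong (_∸ length caught) (sym (does⇒ (_ ℕ.≟ _) complete)))
                       (m+n∸n≡m 1 (length caught))

    step-potential : ∀ p v → Shape p →
      W (step (busy p) v) + cost (Phase.stage p) * χ (progress p v) ≡ W (busy p)
    step-potential p v S = react-potential (progress p v)
      where
      react-potential : ∀ b → W (react b p v) + cost (Phase.stage p) * χ b ≡ W (busy p)
      react-potential false = trans (cong (W (busy p) +_) (*-zeroʳ (cost (Phase.stage p)))) (+-identityʳ _)
      react-potential true  = trans (cong (W (advance (completes p) p v) +_) (*-identityʳ (cost (Phase.stage p))))
                                    (catch-cost (completes p) p v S refl)

    -- In the first stage all but the < n/4 used and < n/2 caught vertices make progress.
    fresh-candidates : ∀ p → Shape p → Phase.fresh p ≡ true →
                       n ≤ cost (Phase.stage p) * countFin (progress p)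
    fresh-candidates (phase emb x todo r ts true pool caught) S _ =
      ≤-trans (quarter-bound n q (countFin used) (countFin caught?) covered used-few caught-few) (*-monoˡ-≤ q (cost≥4 r))
      where
      open Shape S
      used : Fin n → Bool
      used v = does (v ∈? images emb)
      caught? : Fin n → Bool
      caught? v = does (v ∈? caught)
      q : ℕ
      q = countFin (λ v → not (used v) ∧ not (caught? v))
      covered : n ≤ q + (countFin used + countFin caught?)
      covered = begin
        n                                               ≡⟨ sym (count-all n) ⟩
        countFin {n} (λ _ → true)                       ≤⟨ count-cover (λ v → χ-neither (used v) (caught? v)) ⟩
        q + countFin (λ v → used v ∨ caught? v)         ≤⟨ +-monoʳ-≤ q (count-cover (λ v → χ-∨ (used v) (caught? v))) ⟩
        q + (countFin used + countFin caught?)          ∎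
        where open ≤-Reasoning
      used-few : 4 * countFin used ≤ n
      used-few = ≤-trans (*-monoʳ-≤ 4 (begin
        countFin used          ≤⟨ count-∈≤length (images emb) ⟩
        length (images emb)    ≡⟨ length-map proj₂ emb ⟩
        length emb             ≤⟨ m≤m+n (length emb) _ ⟩
        length emb + suc (length todo) ≡⟨ sized ⟩
        h                      ∎)) 4h≤n
        where open ≤-Reasoning
      caught-few : 2 * countFin caught? ≤ n
      caught-few = begin
        2 * countFin caught?   ≤⟨ *-monoʳ-≤ 2 (count-∈≤length caught) ⟩
        2 * length caught      ≤⟨ *-monoʳ-≤ 2 (<⇒≤ caught-short) ⟩
        2 * B ^ r              ≤⟨ *-mono-≤ B≥2 (^-monoʳ-≤ B stage≤e) ⟩
        B ^ suc e              ≤⟨ B^d≤n ⟩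
        n                      ∎
        where open ≤-Reasoning

    n<2^dB^d : n < 2 ^ suc e * B ^ suc e
    n<2^dB^d = begin-strict
      n                  <⟨ n<[B+1]^d ⟩
      suc B ^ suc e      ≤⟨ ^-monoˡ-≤ (suc e) B+1≤2B ⟩
      (2 * B) ^ suc e    ≡⟨ ^-distribʳ-* 2 B (suc e) ⟩
      2 ^ suc e * B ^ suc e ∎
      where
      open ≤-Reasoning
      B+1≤2B : suc B ≤ 2 * B
      B+1≤2B = ≤-trans (+-monoˡ-≤ B (≤-trans (s≤s z≤n) B≥2))
                       (≤-reflexive (cong (B +_) (sym (+-identityʳ B))))

    -- If at least B^{r+1} − B^r arrivals make progress in stage r, then together they
    -- carry cost ≥ cost r · (B^{r+1} − B^r) ≥ 2^d B^d > n.
    later-stage-cost : ∀ r q → r ≤ e → B ^ suc r ≤ q + B ^ r → n ≤ cost r * q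
    later-stage-cost r q r≤e many =
      <⇒≤ (<-≤-trans n<2^dB^d (+-cancelʳ-≤ (P * B ^ suc e) (P * B ^ suc e) (k * q) (begin
        P * B ^ suc e + P * B ^ suc e     ≡⟨ solve₁ P B (B ^ e) ⟩
        B * Q                             ≡⟨ cong (B *_) (sym k·B^r≡Q) ⟩
        B * (k * B ^ r)                   ≡⟨ solve₂ B k (B ^ r) ⟩
        k * B ^ suc r                     ≤⟨ *-monoʳ-≤ k many ⟩
        k * (q + B ^ r)                   ≡⟨ *-distribˡ-+ k q (B ^ r) ⟩
        k * q + k * B ^ r                 ≡⟨ cong (k * q +_) k·B^r≡Q ⟩
        k * q + Q                         ≤⟨ +-monoʳ-≤ (k * q) Q≤ ⟩
        k * q + P * B ^ suc e             ∎)))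
      where
      open ≤-Reasoning
      solve₁ : ∀ P B x → P * (B * x) + P * (B * x) ≡ B * (2 * (P * x))
      solve₁ = solve-∀
      solve₂ : ∀ B k x → B * (k * x) ≡ k * (B * x)
      solve₂ = solve-∀
      solve₃ : ∀ P x → 2 * (P * x) ≡ P * (2 * x)
      solve₃ = solve-∀
      k : ℕ
      k = cost r
      P : ℕ
      P = 2 ^ suc e
      k·B^r≡Q : k * B ^ r ≡ Q
      k·B^r≡Q = trans (*-comm k (B ^ r)) (stage-cost r r≤e)
      Q≤ : Q ≤ P * B ^ suc e
      Q≤ = ≤-trans (≤-reflexive (solve₃ P (B ^ e))) (*-monoʳ-≤ P (*-monoˡ-≤ (B ^ e) B≥2))

    -- In a later stage r all but the < B^r caught vertices of the pool of size B^{r+1}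
    -- make progress.
    pool-candidates : ∀ p → Shape p → Phase.fresh p ≡ false →
                      n ≤ cost (Phase.stage p) * countFin (progress p)
    pool-candidates (phase emb x todo r ts false pool caught) S _ =
      later-stage-cost r q stage≤e (begin
        B ^ suc r                         ≡⟨ sym (proj₂ (pool-shape refl)) ⟩
        length pool                       ≤⟨ count-∈ pool (proj₁ (pool-shape refl)) ⟩
        countFin pooled                   ≤⟨ count-cover (λ v → χ-split (pooled v) (caught? v)) ⟩
        q + countFin caught?              ≤⟨ +-monoʳ-≤ q (count-∈≤length caught) ⟩
        q + length caught                 ≤⟨ +-monoʳ-≤ q (<⇒≤ caught-short) ⟩
        q + B ^ r                         ∎)
      where
      open Shape S
      open ≤-Reasoning
      pooled : Fin n → Bool
      pooled v = does (v ∈? pool)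
      caught? : Fin n → Bool
      caught? v = does (v ∈? caught)
      q : ℕ
      q = countFin (λ v → pooled v ∧ not (caught? v))

    -- some stage always has many candidates, so the potential drops by one in expectation
    candidates : ∀ p → Shape p → n ≤ cost (Phase.stage p) * countFin (progress p)
    candidates p S with Phase.fresh p in fresh
    ... | true  = fresh-candidates p S fresh
    ... | false = pool-candidates p S fresh

    drift : ∀ s → WellShaped s → finished s ≡ false → ∑ (λ v → W (step s v)) + n ≤ n * W s
    drift (busy p) S _ = begin
      ∑W′ + n                                        ≤⟨ +-monoʳ-≤ ∑W′ (candidates p S) ⟩
      ∑W′ + k * countFin (progress p)               ≡⟨ cong (∑W′ +_) (sym (∑-*ˡ k (χ ∘ progress p))) ⟩
      ∑W′ + ∑ (λ v → k * χ (progress p v))          ≡⟨ sym (∑-+ (λ v → W (step (busy p) v)) (λ v → k * χ (progress p v))) ⟩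
      ∑ (λ v → W (step (busy p) v) + k * χ (progress p v)) ≡⟨ ∑-cong (λ v → step-potential p v S) ⟩
      ∑ {n} (λ _ → W (busy p))                      ≡⟨ ∑-const {n} (W (busy p)) ⟩
      n * W (busy p)                                ∎
      where
      open ≤-Reasoning
      k : ℕ
      k = cost (Phase.stage p)
      ∑W′ : ℕ
      ∑W′ = ∑ (λ v → W (step (busy p) v))

    absorbing : ∀ s v → finished s ≡ true → finished (step s v) ≡ true
    absorbing (done _) v _ = refl

    open Averaging WellShaped W step-shape absorbing drift public

  initial-potential : ∀ ord → W (startPhase [] ord) ≤ length ord * (suc e * (2 * 2 ^ suc e)) * B ^ e
  initial-potential []         = z≤n
  initial-potential (x ∷ todo) = ≤-reflexive (begin
    length todo * (suc e * Q) + (e * Q + B ^ e * cost e)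
      ≡⟨ cong (λ y → length todo * (suc e * Q) + (e * Q + y)) (stage-cost e ≤-refl) ⟩
    length todo * (suc e * Q) + (e * Q + Q)     ≡⟨ regroup (length todo) e (2 ^ suc e) (B ^ e) ⟩
    suc (length todo) * (suc e * (2 * 2 ^ suc e)) * B ^ e ∎)
    where
    open ≡-Reasoning
    regroup : ∀ t e P X → t * (suc e * (2 * (P * X))) + (e * (2 * (P * X)) + 2 * (P * X)) ≡
                          suc t * (suc e * (2 * P)) * X
    regroup = solve-∀

rounds-large : ∀ e (m : ℕ → ℕ) → (∀ K → ∃[ N ] (∀ n → N ≤ n → K * n ^ e ≤ m n ^ suc e)) →
               ∀ L → ∃[ N ] (∀ n → N ≤ n → L * root (suc e) n ^ e ≤ m n)
rounds-large e m growth L = proj₁ (growth (L ^ suc e)) , λ n N≤n →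
  ^-cancelʳ-≤ (suc e) (begin
    (L * root (suc e) n ^ e) ^ suc e         ≡⟨ ^-distribʳ-* L (root (suc e) n ^ e) (suc e) ⟩
    L ^ suc e * (root (suc e) n ^ e) ^ suc e ≡⟨ cong (L ^ suc e *_) (^-swap (root (suc e) n) e (suc e)) ⟩
    L ^ suc e * (root (suc e) n ^ suc e) ^ e ≤⟨ *-monoʳ-≤ (L ^ suc e) (^-monoˡ-≤ e (root-lower e n)) ⟩
    L ^ suc e * n ^ e                        ≤⟨ proj₂ (growth (L ^ suc e)) n N≤n ⟩
    m n ^ suc e                              ∎)
  where
  open ≤-Reasoning
  ^-swap : ∀ b i j → (b ^ i) ^ j ≡ (b ^ j) ^ i
  ^-swap b i j = trans (^-*-assoc b i j) (trans (cong (b ^_) (*-comm i j)) (sym (^-*-assoc b j i)))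

fraction-bound : ∀ k W m bad total → suc k * suc W ≤ m → m * bad ≤ W * total → suc k * bad ≤ total
fraction-bound k W m bad total m-large m-bad = *-cancelʳ-≤ (suc k * bad) total (suc W) (begin
  suc k * bad * suc W   ≡⟨ swap (suc k) bad (suc W) ⟩
  suc k * suc W * bad   ≤⟨ *-monoˡ-≤ bad m-large ⟩
  m * bad               ≤⟨ m-bad ⟩
  W * total             ≤⟨ *-monoˡ-≤ total (n≤1+n W) ⟩
  suc W * total         ≡⟨ *-comm (suc W) total ⟩
  total * suc W         ∎)
  where
  open ≤-Reasoning
  swap : ∀ a b c → a * b * c ≡ a * c * b
  swap = solve-∀

-- With a single random seed, the counts of the statement are counts of sequences.
one-seed-total : ∀ n m → totalCount n m 0 ≡ n ^ m
one-seed-total n m = +-identityʳ (n ^ m)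

one-seed-failures : ∀ n m (good : Fin 1 → Vec (Fin n) m → Bool) →
  totalCount n m 0 ∸ goodCount n m 0 good ≡ countVec n m (not ∘ good fzero)
one-seed-failures n m good = begin
  totalCount n m 0 ∸ goodCount n m 0 good   ≡⟨ cong₂ _∸_ (one-seed-total n m) (+-identityʳ c) ⟩
  n ^ m ∸ c                                 ≡⟨ cong (_∸ c) (sym (countVec-complement n m (good fzero))) ⟩
  c + countVec n m (not ∘ good fzero) ∸ c   ≡⟨ m+n∸m≡n c _ ⟩
  countVec n m (not ∘ good fzero)           ∎
  where
  open ≡-Reasoning
  c : ℕ
  c = countVec n m (good fzero)

-- The theorem for H of degeneracy d = e+1: Builder runs the machine with
-- B = ⌊n^{1/d}⌋ on an admissible ordering of V(H) (no randomness: one seed).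
module Construction (H : Graph) (e : ℕ) (degenerate : Degenerate H (suc e)) (m : ℕ → ℕ)
  (growth : ∀ K → ∃[ N ] (∀ n → N ≤ n → K * n ^ e ≤ m n ^ suc e)) where

  open DegeneracyOrder H (suc e) using (Ordering; ordering)

  all-vertices : Ordering (λ _ → true)
  all-vertices = ordering degenerate (size H) (λ _ → true) (≤-reflexive (count-all (size H)))

  open Ordering all-vertices using (order; admissible; complete)

  h : ℕ
  h = length order

  module Machine (n : ℕ) = Builder H e n (root (suc e) n)

  initial : (n : ℕ) → Machine.State n
  initial n = Machine.startPhase n [] order

  σ : (n : ℕ) → Fin 1 → Strategy n
  σ n _ = Machine.strategy n (initial n)

  good : (n : ℕ) → Fin 1 → Vec (Fin n) (m n) → Bool
  good n _ vs = Machine.finished n (Machine.run n (initial n) vs)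

  good⇒copy : ∀ n r vs → good n r vs ≡ true → HasCopy H (play (σ n r) [] vs)
  good⇒copy n _ vs fin = subst (HasCopy H) (sym (Machine.play≡trace n (initial n) [] vs))
    (Machine.finished⇒copy n order admissible (λ i → complete i refl) vs fin)

  C : ℕ
  C = h * (suc e * (2 * 2 ^ suc e))

  few-failures : ∀ k n → 2 ^ suc e + 4 * h ≤ n → suc k * suc C * root (suc e) n ^ e ≤ m n →
                 suc k * Machine.unfinished n (m n) (initial n) ≤ n ^ m n
  few-failures k n n-large m-large =
    fraction-bound k (W (initial n)) (m n) _ (n ^ m n) enough
      (averaging (m n) (initial n) (start-shape [] order refl))
    where
    B : ℕ
    B = root (suc e) n
    open Machine n
    open Running h (root-≥2 e n (≤-trans (m≤m+n (2 ^ suc e) (4 * h)) n-large))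
                 (root-lower e n) (root-upper e n) (≤-trans (m≤n+m (4 * h) (2 ^ suc e)) n-large)
    enough : suc k * suc (W (initial n)) ≤ m n
    enough = begin
      suc k * suc (W (initial n))   ≤⟨ *-monoʳ-≤ (suc k) (+-mono-≤ (B^-positive e) (initial-potential order)) ⟩
      suc k * (B ^ e + C * B ^ e) ≡⟨ sym (*-assoc (suc k) (suc C) (B ^ e)) ⟩
      suc k * suc C * B ^ e       ≤⟨ m-large ⟩
      m n                         ∎
      where open ≤-Reasoning

  failures-vanish : ∀ k → ∃[ N ] (∀ n → N ≤ n →
    suc k * (totalCount n (m n) 0 ∸ goodCount n (m n) 0 (good n)) ≤ totalCount n (m n) 0)
  failures-vanish k = N + (2 ^ suc e + 4 * h) , bound
    where
    N : ℕ
    N = proj₁ (rounds-large e m growth (suc k * suc C))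
    bound : ∀ n → N + (2 ^ suc e + 4 * h) ≤ n →
      suc k * (totalCount n (m n) 0 ∸ goodCount n (m n) 0 (good n)) ≤ totalCount n (m n) 0
    bound n n-large rewrite one-seed-failures n (m n) (good n) | one-seed-total n (m n) =
      few-failures k n (≤-trans (m≤n+m _ N) n-large)
        (proj₂ (rounds-large e m growth (suc k * suc C)) n (≤-trans (m≤m+n N _) n-large))

theorem1p11 : (H : Graph) (d : ℕ) → IsDegeneracy H d → 1 ≤ d →
    (m : ℕ → ℕ) →
    (∀ (K : ℕ) → ∃[ N ] (∀ (n : ℕ) → N ≤ n → K * n ^ (d ∸ 1) ≤ m n ^ d)) →
    Σ (ℕ → ℕ) λ s →
    Σ ((n : ℕ) → Fin (suc (s n)) → Strategy n) λ σ →
    Σ ((n : ℕ) → Fin (suc (s n)) → Vec (Fin n) (m n) → Bool) λ good →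
      ((∀ (n : ℕ) (r : Fin (suc (s n))) (vs : Vec (Fin n) (m n)) → good n r vs ≡ true →
          HasCopy H (play (σ n r) [] vs))
      × (∀ (k : ℕ) → ∃[ N ] (∀ (n : ℕ) → N ≤ n →
          suc k * (totalCount n (m n) (s n) ∸ goodCount n (m n) (s n) (good n))
            ≤ totalCount n (m n) (s n))))
theorem1p11 H (suc e) (degenerate , _) _ m growth =
  (λ _ → 0) , σ , good , good⇒copy , failures-vanish
  where open Construction H e degenerate m growth
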